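{- Let $G$ be a finite group, let $N$ be a subgroup of $G$, and let $p(G)$ denote the smallest prime divisor of $|G|$. For $a \in G$ write $\overline{a} = aN$, and for $X \subseteq G$ write $\overline{X} = \{\overline{x} : x \in X\}$. Let $A$ and $B$ be nonempty subsets of $G$ with $\overline{1} \in \overline{A} \cap \overline{B}$. If $|\overline{B}| \ge 2$, then $$|\overline{AB \cup BA}| \ge \min\{p(G), |\overline{A}| + 1\},$$ where $AB = \{ab : a \in A, b \in B\}$ and $BA = \{ba : a \in A, b \in B\}$.
   Context: Here $\overline{X}$ is the set of left cosets of $N$ meeting $X$, and $|\overline{X}|$ is the number of such cosets. -}

module Defs where

open import Level using (0ℓ)
open import Data.Nat using (ℕ; _≤_)
open import Data.Nat.Divisibility using (_∣_)
open import Data.Nat.Primality using (Prime)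
open import Data.Bool using (Bool)
import Data.Bool as Bool
open import Data.Fin using (Fin)
open import Data.Fin.Properties using (any?) renaming (_≟_ to _≟ᶠ_)
open import Data.Fin.Subset using (Subset; _∈_)
open import Data.Fin.Subset.Properties using (_∈?_)
open import Data.Vec using (tabulate)
open import Data.Vec.Properties using (≡-dec)
open import Data.List using (List; map; filter; deduplicate; allFin; length)
open import Data.Product using (_×_; Σ-syntax; ∃)
open import Data.Sum using (_⊎_)
open import Relation.Nullary using (does; _×-dec_; _⊎-dec_)
open import Relation.Binary.PropositionalEquality using (_≡_)
open import Algebra.Structures using (IsGroup)

-- A finite group of order n: a group structure on Fin n
-- (every finite group is isomorphic to one of this form).
record FinGroup (n : ℕ) : Set where
  field
    _∙_ : Fin n → Fin n → Fin n
    e   : Fin n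
    inv : Fin n → Fin n
    isGroup : IsGroup {A = Fin n} _≡_ _∙_ e inv

IsSmallestPrimeDivisor : ℕ → ℕ → Set
IsSmallestPrimeDivisor p n = Prime p × p ∣ n × (∀ q → Prime q → q ∣ n → p ≤ q)

module _ {n : ℕ} (G : FinGroup n) where
  open FinGroup G

  IsSubgroup : Subset n → Set
  IsSubgroup N = e ∈ N × (∀ x y → x ∈ N → y ∈ N → (x ∙ y) ∈ N)
                       × (∀ x → x ∈ N → inv x ∈ N)

  coset : Subset n → Fin n → Subset n
  coset N x = tabulate (λ g → does ((inv x ∙ g) ∈? N))

  bar : Subset n → Subset n → List (Subset n)
  bar N X = deduplicate (≡-dec Bool._≟_) (map (coset N) (filter (_∈? X) (allFin n)))

  ∣bar∣ : Subset n → Subset n → ℕ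
  ∣bar∣ N X = length (bar N X)

  ABuBA : Subset n → Subset n → Subset n
  ABuBA A B = tabulate λ g → does (any? λ a → any? λ b →
      (a ∈? A) ×-dec ((b ∈? B) ×-dec ((g ≟ᶠ (a ∙ b)) ⊎-dec (g ≟ᶠ (b ∙ a)))))

{-# OPTIONS --safe #-}
module Submission where

-- Pick b ∈ B ∖ N (as |B̄| ≥ 2) and b₀ ∈ B ∩ N (as 1̄ ∈ B̄). Since a b₀ N = a N, every coset of Ā
-- meets AB, so Ā ⊆ (AB ∪ BA)‾. If some b a (a ∈ A) lies in a coset outside Ā, that coset is
-- one more. Otherwise left multiplication by b maps Ā into itself, so Ā contains the cosets
-- b^k N, which are distinct for 0 ≤ k < m, where m > 1 is the least positive exponent with
-- b^m ∈ N. Now m divides the order of b, which divides |G| because every orbit of y ↦ b y has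
-- exactly that size; hence m ≥ p(G).

open import Level using (0ℓ)
open import Function using (_∘_; _⇔_; mk⇔; Equivalence)
open import Algebra.Bundles using (Group)
open import Algebra.Structures using (IsGroup)
import Data.Bool as Bool
open import Data.Product using (_×_; _,_; ∃; ∃-syntax; proj₁; proj₂)
open import Data.Sum using (_⊎_; inj₁; inj₂)
open import Data.Nat using (ℕ; zero; suc; pred; _+_; _*_; _∸_; _⊓_; _≤_; _<_; z≤n; s≤s;
  NonZero; >-nonZero; >-nonZero⁻¹)
open import Data.Nat.Properties using (_<?_; +-comm; +-suc; +-identityʳ; ≤-trans; ≤-antisym; <⇒≤;
  ≤-<-trans;   n<1+n; >⇒≢; ≮⇒≥; n≤0⇒n≡0; m≤n⇒m<n∨m≡n; m<1+n⇒m<n∨m≡n; m∸n≤m; m+[n∸m]≡n; m<n⇒0<n∸m; suc-pred;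
  m⊓n≤m; m⊓n≤n; module ≤-Reasoning)
open import Data.Nat.DivMod using (_%_; _/_; m≡m%n+[m/n]*n; m%n<n)
open import Data.Nat.Divisibility using (_∣_; _∣0; ∣-refl; ∣-trans; ∣⇒≤; m∣m*n; m%n≡0⇒n∣m; ∣m∣n⇒∣m+n)
open import Data.Nat.GeneralisedArithmetic using (fold; fold-+; fold-pull)
open import Data.Nat.Induction using (<-wellFounded)
open import Data.Nat.ListAction using (product)
open import Data.Nat.Primality.Factorisation using (factorise; PrimeFactorisation)
open import Data.Fin using (Fin; toℕ) renaming (_≟_ to _≟ᶠ_)
open import Data.Fin.Properties using (pigeonhole; any?)
open import Data.Fin.Subset using (Subset; Nonempty; _∈_; _∉_)
open import Data.Fin.Subset.Properties using (_∈?_)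
open import Data.Vec using (tabulate)
open import Data.Vec.Properties using (≡-dec; lookup∘tabulate; lookup⇒[]=; []=⇒lookup; tabulate-cong)
open import Data.List using (List; []; _∷_; length; filter; applyUpTo; allFin)
open import Data.List.Properties using (filter-notAll; length-applyUpTo; length-tabulate)
open import Data.List.Membership.Propositional using () renaming (_∈_ to _∈ˡ_)
open import Data.List.Membership.Propositional.Properties using (∈-filter⁺; ∈-filter⁻; ∈-applyUpTo⁺;
  ∈-applyUpTo⁻; ∈-allFin; ∈-map⁺; ∈-map⁻; ∈-deduplicate⁺; ∈-deduplicate⁻)
import Data.List.Membership.DecPropositional as DecMembership
open import Data.List.Relation.Binary.Subset.Propositional using (_⊆_)
open import Data.List.Relation.Unary.All as All using (_∷_)
open import Data.List.Relation.Unary.All.Properties using (¬Any⇒All¬)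
open import Data.List.Relation.Unary.Any as Any using (here; there)
open import Data.List.Relation.Unary.Unique.Propositional using (Unique; _∷_)
import Data.List.Relation.Unary.Unique.Propositional.Properties as Unique
open import Data.List.Relation.Unary.Unique.DecPropositional.Properties using (deduplicate-!)
open import Induction.WellFounded using (Acc; acc)
open import Relation.Nullary using (¬_; Dec; yes; no; does; ¬?; _×-dec_; _⊎-dec_; contradiction)
open import Relation.Nullary.Decidable using (dec-true; does-⇔; decidable-stable)
open import Relation.Unary using (Pred; Decidable)
open import Relation.Binary using (DecidableEquality)
open import Relation.Binary.PropositionalEquality
  using (_≡_; refl; sym; trans; cong; subst; module ≡-Reasoning)
open import Defs

module _ {A : Set} {P : Pred A 0ℓ} (P? : Decidable P) where

  length-filter-split : ∀ xs → length (filter P? xs) + length (filter (¬? ∘ P?) xs) ≡ length xs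
  length-filter-split [] = refl
  length-filter-split (x ∷ xs) with P? x
  ... | yes _ = cong suc (length-filter-split xs)
  ... | no _ = trans (+-suc _ _) (cong suc (length-filter-split xs))

module _ {A : Set} (_≟_ : DecidableEquality A) where

  unique⊆⇒length≤ : ∀ {xs ys : List A} → Unique xs → xs ⊆ ys → length xs ≤ length ys
  unique⊆⇒length≤ {[]} _ _ = z≤n
  unique⊆⇒length≤ {x ∷ xs} {ys} (x∉xs ∷ xs!) xs⊆ys = begin-strict
    length xs                     ≤⟨ unique⊆⇒length≤ xs! xs⊆ys-x ⟩
    length (filter (x ≢?_) ys)    <⟨ filter-notAll (x ≢?_) ys x∈ys ⟩
    length ys                     ∎
    where
    open ≤-Reasoning
    x∈ys : Any.Any (λ y → ¬ ¬ x ≡ y) ys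
    x∈ys = Any.map (λ x≡y x≢y → x≢y x≡y) (xs⊆ys (here refl))
    _≢?_ : ∀ a b → Dec (¬ a ≡ b)
    a ≢? b = ¬? (a ≟ b)
    xs⊆ys-x : xs ⊆ filter (x ≢?_) ys
    xs⊆ys-x z∈xs = ∈-filter⁺ (x ≢?_) (xs⊆ys (there z∈xs)) (All.lookup x∉xs z∈xs)

  unique-⊆⊇⇒length≡ : ∀ {xs ys : List A} → Unique xs → Unique ys → xs ⊆ ys → ys ⊆ xs →
                       length xs ≡ length ys
  unique-⊆⊇⇒length≡ xs! ys! xs⊆ys ys⊆xs =
    ≤-antisym (unique⊆⇒length≤ xs! xs⊆ys) (unique⊆⇒length≤ ys! ys⊆xs)

two-distinct : ∀ {A : Set} {vs : List A} → Unique vs → 2 ≤ length vs →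
               ∃[ v ] ∃[ w ] v ∈ˡ vs × w ∈ˡ vs × ¬ v ≡ w
two-distinct {vs = v ∷ w ∷ _} ((v≢w ∷ _) ∷ _) _ = v , w , here refl , there (here refl) , v≢w
two-distinct {vs = _ ∷ []} _ (s≤s ())

IsLeastPositive : Pred ℕ 0ℓ → ℕ → Set
IsLeastPositive P m = 0 < m × P m × (∀ {j} → 0 < j → j < m → ¬ P j)

module _ {P : Pred ℕ 0ℓ} (P? : Decidable P) where

  private
    search : ∀ i k → (∀ {j} → j < i → ¬ P j) → P (i + k) → ∃[ m ] P m × (∀ {j} → j < m → ¬ P j)
    search i k below P[i+k] with P? i
    ... | yes Pi = i , Pi , below
    search i zero below P[i+0] | no ¬Pi = contradiction (subst P (+-identityʳ i) P[i+0]) ¬Pi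
    search i (suc k) below P[i+1+k] | no ¬Pi = search (suc i) k below′ (subst P (+-suc i k) P[i+1+k])
      where
      below′ : ∀ {j} → j < suc i → ¬ P j
      below′ j<1+i with m<1+n⇒m<n∨m≡n j<1+i
      ... | inj₁ j<i = below j<i
      ... | inj₂ refl = ¬Pi

  least : ∀ {k} → P k → ∃[ m ] P m × (∀ {j} → j < m → ¬ P j)
  least = search 0 _ (λ ())

least-positive : ∀ {P : Pred ℕ 0ℓ} → Decidable P → ∀ {k} → 0 < k → P k → ∃ (IsLeastPositive P)
least-positive P? 0<k Pk with least (λ j → (0 <? j) ×-dec P? j) (0<k , Pk)
... | m , (0<m , Pm) , below = m , 0<m , Pm , λ 0<j j<m Pj → below j<m (0<j , Pj)

smallest-prime-divisor≤ : ∀ {p n m} → IsSmallestPrimeDivisor p n → 2 ≤ m → m ∣ n → p ≤ m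
smallest-prime-divisor≤ {m = m@(suc _)} (_ , _ , p≤primes) 2≤m m∣n
  with PrimeFactorisation.factors (factorise m)
     | PrimeFactorisation.isFactorisation (factorise m)
     | PrimeFactorisation.factorsPrime (factorise m)
... | [] | m≡1 | _ = contradiction m≡1 (>⇒≢ 2≤m)
... | q ∷ qs | m≡q*qs | q-prime ∷ _ = ≤-trans (p≤primes q q-prime (∣-trans q∣m m∣n)) (∣⇒≤ q∣m)
  where
  q∣m : q ∣ m
  q∣m = subst (q ∣_) (sym m≡q*qs) (m∣m*n (product qs))

module _ {n : ℕ} {P : Pred (Fin n) 0ℓ} (P? : Decidable P) where

  ∈-tabulate⁺ : ∀ {x} → P x → x ∈ tabulate (does ∘ P?)
  ∈-tabulate⁺ {x} Px = lookup⇒[]= x _ (trans (lookup∘tabulate _ x) (dec-true (P? x) Px))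

  ∈-tabulate⁻ : ∀ {x} → x ∈ tabulate (does ∘ P?) → P x
  ∈-tabulate⁻ {x} x∈ with P? x | trans (sym (lookup∘tabulate (does ∘ P?) x)) ([]=⇒lookup x∈)
  ... | yes Px | _ = Px
  ... | no _ | ()

orbit : {A : Set} → (A → A) → ℕ → A → List A
orbit f d x = applyUpTo (fold x f) d

module _ {A : Set} (f : A → A) where

  Closed : List A → Set
  Closed ys = ∀ {y} → y ∈ˡ ys → f y ∈ˡ ys

  fold-closed : ∀ {ys y} → Closed ys → y ∈ˡ ys → ∀ k → fold y f k ∈ˡ ys
  fold-closed closed y∈ys zero = y∈ys
  fold-closed closed y∈ys (suc k) = closed (fold-closed closed y∈ys k)

  fold-suc : ∀ y k → fold (f y) f k ≡ fold y f (suc k)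
  fold-suc y k = trans (sym (fold-+ y f k)) (cong (fold y f) (+-comm k 1))

module _ {A : Set} (_≟_ : DecidableEquality A) (f : A → A) (d : ℕ) .{{_ : NonZero d}}
         (periodic : ∀ x → fold x f d ≡ x) (orbit-unique : ∀ x → Unique (orbit f d x)) where

  open DecMembership _≟_ using () renaming (_∈?_ to _∈ˡ?_)

  x∈orbit : ∀ x → x ∈ˡ orbit f d x
  x∈orbit x = ∈-applyUpTo⁺ (fold x f) (>-nonZero⁻¹ d)

  orbit-closed : ∀ x → Closed f (orbit f d x)
  orbit-closed x y∈ with ∈-applyUpTo⁻ (fold x f) y∈
  ... | t , t<d , refl with m≤n⇒m<n∨m≡n t<d
  ...   | inj₁ 1+t<d = ∈-applyUpTo⁺ (fold x f) 1+t<d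
  ...   | inj₂ 1+t≡d = subst (λ k → fold x f k ∈ˡ orbit f d x) (sym 1+t≡d)
                         (subst (_∈ˡ orbit f d x) (sym (periodic x)) (x∈orbit x))

  orbit-closed⁻ : ∀ {x y} → f y ∈ˡ orbit f d x → y ∈ˡ orbit f d x
  orbit-closed⁻ {x} {y} fy∈ = subst (_∈ˡ orbit f d x) y≡ (fold-closed f (orbit-closed x) fy∈ (pred d))
    where
    y≡ : fold (f y) f (pred d) ≡ y
    y≡ = trans (fold-suc f y (pred d)) (trans (cong (fold y f) (suc-pred d)) (periodic y))

  private
    divides : ∀ xs → Acc _<_ (length xs) → Unique xs → Closed f xs → d ∣ length xs
    divides [] _ _ _ = d ∣0
    divides xs@(x ∷ _) (acc rs) xs! closed =
      subst (d ∣_) (length-filter-split in-orbit? xs) (∣m∣n⇒∣m+n d∣inside d∣outside)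
      where
      in-orbit? : Decidable (_∈ˡ orbit f d x)
      in-orbit? = _∈ˡ? orbit f d x

      inside outside : List A
      inside = filter in-orbit? xs
      outside = filter (¬? ∘ in-orbit?) xs

      orbit⊆xs : orbit f d x ⊆ xs
      orbit⊆xs z∈ with ∈-applyUpTo⁻ (fold x f) z∈
      ... | t , _ , refl = fold-closed f closed (here refl) t

      inside-length : length inside ≡ d
      inside-length = trans
        (unique-⊆⊇⇒length≡ _≟_ (Unique.filter⁺ in-orbit? xs!) (orbit-unique x)
          (λ z∈ → proj₂ (∈-filter⁻ in-orbit? {xs = xs} z∈))
          (λ z∈ → ∈-filter⁺ in-orbit? (orbit⊆xs z∈) z∈))
        (length-applyUpTo (fold x f) d)

      d∣inside : d ∣ length inside
      d∣inside = subst (d ∣_) (sym inside-length) ∣-refl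

      outside-closed : Closed f outside
      outside-closed z∈ with ∈-filter⁻ (¬? ∘ in-orbit?) {xs = xs} z∈
      ... | z∈xs , z∉ = ∈-filter⁺ (¬? ∘ in-orbit?) (closed z∈xs) (z∉ ∘ orbit-closed⁻)

      d∣outside : d ∣ length outside
      d∣outside = divides outside
        (rs (filter-notAll (¬? ∘ in-orbit?) xs (here λ x∉ → x∉ (x∈orbit x))))
        (Unique.filter⁺ (¬? ∘ in-orbit?) xs!) outside-closed

  period-∣-length : ∀ {xs} → Unique xs → Closed f xs → d ∣ length xs
  period-∣-length {xs} = divides xs (<-wellFounded (length xs))

module FinGroupProperties {n : ℕ} (G : FinGroup n) where

  open FinGroup G
  open IsGroup isGroup using (assoc; identityˡ; identityʳ; inverseˡ)

  group : Group 0ℓ 0ℓ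
  group = record { isGroup = isGroup }

  open import Algebra.Properties.Group group
    using (\\-leftDividesˡ; \\-leftDividesʳ; //-rightDividesʳ; ∙-cancelʳ; ⁻¹-anti-homo-∙; ⁻¹-involutive; ε⁻¹≈ε)

  -- binds tighter than the field _∙_, which has the default fixity 20
  infixr 30 _^_
  _^_ : Fin n → ℕ → Fin n
  b ^ k = fold e (b ∙_) k

  fold-∙ : ∀ b x k → fold x (b ∙_) k ≡ b ^ k ∙ x
  fold-∙ b x = fold-pull e (b ∙_) _∙_ x (identityˡ x) (λ y → sym (assoc b y x))

  ^-+ : ∀ b i j → b ^ (i + j) ≡ b ^ i ∙ b ^ j
  ^-+ b i j = trans (fold-+ e (b ∙_) i) (fold-∙ b (b ^ j) i)

  ^-∸ : ∀ b {i j} → i ≤ j → inv (b ^ i) ∙ b ^ j ≡ b ^ (j ∸ i)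
  ^-∸ b {i} {j} i≤j = begin
    inv (b ^ i) ∙ b ^ j                   ≡⟨ cong (λ k → inv (b ^ i) ∙ b ^ k) (sym (m+[n∸m]≡n i≤j)) ⟩
    inv (b ^ i) ∙ b ^ (i + (j ∸ i))       ≡⟨ cong (inv (b ^ i) ∙_) (^-+ b i (j ∸ i)) ⟩
    inv (b ^ i) ∙ (b ^ i ∙ b ^ (j ∸ i))   ≡⟨ \\-leftDividesʳ (b ^ i) (b ^ (j ∸ i)) ⟩
    b ^ (j ∸ i)                           ∎
    where open ≡-Reasoning

  powers-distinct : ∀ (P : Pred (Fin n) 0ℓ) {b m} → IsLeastPositive (λ k → P (b ^ k)) m →
                    ∀ {i j} → i < j → j < m → ¬ P (inv (b ^ i) ∙ b ^ j)
  powers-distinct P {b} (_ , _ , minimal) {i} {j} i<j j<m P[b^i\\b^j] =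
    minimal (m<n⇒0<n∸m i<j) (≤-<-trans (m∸n≤m j i) j<m) (subst P (^-∸ b (<⇒≤ i<j)) P[b^i\\b^j])

  x≡y⇒x⁻¹∙y≡e : ∀ {x y} → x ≡ y → inv x ∙ y ≡ e
  x≡y⇒x⁻¹∙y≡e {x} refl = inverseˡ x

  IsOrder : Fin n → ℕ → Set
  IsOrder b = IsLeastPositive (λ k → b ^ k ≡ e)

  order-exists : ∀ b → ∃ (IsOrder b)
  order-exists b with pigeonhole (n<1+n n) (λ i → b ^ toℕ i)
  ... | i , j , i<j , b^i≡b^j = least-positive (λ k → b ^ k ≟ᶠ e) (m<n⇒0<n∸m i<j) b^[j∸i]≡e
    where
    b^[j∸i]≡e : b ^ (toℕ j ∸ toℕ i) ≡ e
    b^[j∸i]≡e = trans (sym (^-∸ b (<⇒≤ i<j))) (x≡y⇒x⁻¹∙y≡e b^i≡b^j)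

  order-∣ : ∀ {b d} → IsOrder b d → d ∣ n
  order-∣ {b} {d} b-order@(0<d , b^d≡e , _) =
    subst (d ∣_) (length-tabulate (λ x → x))
      (period-∣-length _≟ᶠ_ (b ∙_) d periodic orbit-unique (Unique.allFin⁺ n) (λ _ → ∈-allFin _))
    where
    instance
      d≢0 : NonZero d
      d≢0 = >-nonZero 0<d

    periodic : ∀ x → fold x (b ∙_) d ≡ x
    periodic x = trans (fold-∙ b x d) (trans (cong (_∙ x) b^d≡e) (identityˡ x))

    orbit-unique : ∀ x → Unique (orbit (b ∙_) d x)
    orbit-unique x = Unique.applyUpTo⁺₁ (fold x (b ∙_)) d λ {i} {j} i<j j<d b^i·x≡b^j·x →
      powers-distinct (_≡ e) b-order i<j j<d (x≡y⇒x⁻¹∙y≡e (∙-cancelʳ x (b ^ i) (b ^ j)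
        (trans (sym (fold-∙ b x i)) (trans b^i·x≡b^j·x (fold-∙ b x j)))))

  module Subgroup (N : Subset n) (N≤G : IsSubgroup G N) where

    e∈N : e ∈ N
    e∈N = proj₁ N≤G

    ∙-closed : ∀ x y → x ∈ N → y ∈ N → x ∙ y ∈ N
    ∙-closed = proj₁ (proj₂ N≤G)

    inv-closed : ∀ x → x ∈ N → inv x ∈ N
    inv-closed = proj₂ (proj₂ N≤G)

    infix 4 _≈ᴺ_
    _≈ᴺ_ : Fin n → Fin n → Set
    x ≈ᴺ y = inv x ∙ y ∈ N

    ≈ᴺ-refl : ∀ x → x ≈ᴺ x
    ≈ᴺ-refl x = subst (_∈ N) (sym (inverseˡ x)) e∈N

    ≈ᴺ-sym : ∀ {x y} → x ≈ᴺ y → y ≈ᴺ x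
    ≈ᴺ-sym {x} {y} x≈y = subst (_∈ N) inv[x⁻¹y]≡y⁻¹x (inv-closed _ x≈y)
      where
      inv[x⁻¹y]≡y⁻¹x : inv (inv x ∙ y) ≡ inv y ∙ x
      inv[x⁻¹y]≡y⁻¹x = trans (⁻¹-anti-homo-∙ (inv x) y) (cong (inv y ∙_) (⁻¹-involutive x))

    ≈ᴺ-trans : ∀ {x y z} → x ≈ᴺ y → y ≈ᴺ z → x ≈ᴺ z
    ≈ᴺ-trans {x} {y} {z} x≈y y≈z = subst (_∈ N) cancel (∙-closed _ _ x≈y y≈z)
      where
      open ≡-Reasoning
      cancel : (inv x ∙ y) ∙ (inv y ∙ z) ≡ inv x ∙ z
      cancel = begin
        (inv x ∙ y) ∙ (inv y ∙ z)  ≡⟨ assoc (inv x) y (inv y ∙ z) ⟩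
        inv x ∙ (y ∙ (inv y ∙ z))  ≡⟨ cong (inv x ∙_) (\\-leftDividesˡ y z) ⟩
        inv x ∙ z                  ∎

    ≈ᴺ-∙ˡ : ∀ g {x y} → x ≈ᴺ y → g ∙ x ≈ᴺ g ∙ y
    ≈ᴺ-∙ˡ g {x} {y} x≈y = subst (_∈ N) (sym cancel) x≈y
      where
      open ≡-Reasoning
      cancel : inv (g ∙ x) ∙ (g ∙ y) ≡ inv x ∙ y
      cancel = begin
        inv (g ∙ x) ∙ (g ∙ y)      ≡⟨ cong (_∙ (g ∙ y)) (⁻¹-anti-homo-∙ g x) ⟩
        (inv x ∙ inv g) ∙ (g ∙ y)  ≡⟨ assoc (inv x) (inv g) (g ∙ y) ⟩
        inv x ∙ (inv g ∙ (g ∙ y))  ≡⟨ cong (inv x ∙_) (\\-leftDividesʳ g y) ⟩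
        inv x ∙ y                  ∎

    e≈ᴺ⇔∈N : ∀ {x} → e ≈ᴺ x ⇔ x ∈ N
    e≈ᴺ⇔∈N {x} = mk⇔ (subst (_∈ N) e⁻¹x≡x) (subst (_∈ N) (sym e⁻¹x≡x))
      where
      e⁻¹x≡x : inv e ∙ x ≡ x
      e⁻¹x≡x = trans (cong (_∙ x) ε⁻¹≈ε) (identityˡ x)

    ∈-coset⇔ : ∀ {x g} → g ∈ coset G N x ⇔ x ≈ᴺ g
    ∈-coset⇔ {x} = mk⇔ (∈-tabulate⁻ (λ g → inv x ∙ g ∈? N)) (∈-tabulate⁺ (λ g → inv x ∙ g ∈? N))

    coset-injective : ∀ {x y} → coset G N x ≡ coset G N y → x ≈ᴺ y
    coset-injective {y = y} xN≡yN =
      Equivalence.to ∈-coset⇔ (subst (y ∈_) (sym xN≡yN) (Equivalence.from ∈-coset⇔ (≈ᴺ-refl y)))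

    coset-cong : ∀ {x y} → x ≈ᴺ y → coset G N x ≡ coset G N y
    coset-cong {x} {y} x≈y = tabulate-cong λ g →
      does-⇔ (mk⇔ (≈ᴺ-trans (≈ᴺ-sym x≈y)) (≈ᴺ-trans x≈y)) (inv x ∙ g ∈? N) (inv y ∙ g ∈? N)

    _≟ˢ_ : DecidableEquality (Subset n)
    _≟ˢ_ = ≡-dec Bool._≟_

    ∈-bar⁺ : ∀ {X x} → x ∈ X → coset G N x ∈ˡ bar G N X
    ∈-bar⁺ {X} {x} x∈X = ∈-deduplicate⁺ _≟ˢ_ (∈-map⁺ (coset G N) (∈-filter⁺ (_∈? X) (∈-allFin x) x∈X))

    ∈-bar⁻ : ∀ {X v} → v ∈ˡ bar G N X → ∃[ x ] x ∈ X × v ≡ coset G N x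
    ∈-bar⁻ {X} v∈ with ∈-map⁻ (coset G N) (∈-deduplicate⁻ _≟ˢ_ _ v∈)
    ... | x , x∈ , v≡xN = x , proj₂ (∈-filter⁻ (_∈? X) {xs = allFin n} x∈) , v≡xN

    bar-unique : ∀ X → Unique (bar G N X)
    bar-unique X = deduplicate-! _≟ˢ_ _

    ∈N⇒coset≡N : ∀ {x} → x ∈ N → coset G N x ≡ coset G N e
    ∈N⇒coset≡N x∈N = sym (coset-cong (Equivalence.from e≈ᴺ⇔∈N x∈N))

    two-cosets⇒∉N : ∀ {X} → 2 ≤ ∣bar∣ G N X → ∃[ x ] x ∈ X × x ∉ N
    two-cosets⇒∉N {X} 2≤∣X̄∣ with two-distinct (bar-unique X) 2≤∣X̄∣
    ... | v , w , v∈ , w∈ , v≢w with ∈-bar⁻ v∈ | ∈-bar⁻ w∈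
    ...   | x , x∈X , refl | y , y∈X , refl with x ∈? N
    ...     | no x∉N = x , x∈X , x∉N
    ...     | yes x∈N = y , y∈X , λ y∈N → v≢w (trans (∈N⇒coset≡N x∈N) (sym (∈N⇒coset≡N y∈N)))

    IsOrderModulo : Fin n → ℕ → Set
    IsOrderModulo b = IsLeastPositive (λ k → b ^ k ∈ N)

    order-modulo-exists : ∀ b → ∃ (IsOrderModulo b)
    order-modulo-exists b with order-exists b
    ... | _ , 0<d , b^d≡e , _ = least-positive (λ k → b ^ k ∈? N) 0<d (subst (_∈ N) (sym b^d≡e) e∈N)

    ^-*-∈N : ∀ {b m} → b ^ m ∈ N → ∀ q → b ^ (q * m) ∈ N
    ^-*-∈N _ zero = e∈N
    ^-*-∈N {b} {m} b^m∈N (suc q) =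
      subst (_∈ N) (sym (^-+ b m (q * m))) (∙-closed _ _ b^m∈N (^-*-∈N b^m∈N q))

    order-modulo-∣ : ∀ {b m k} → IsOrderModulo b m → b ^ k ∈ N → m ∣ k
    order-modulo-∣ {b} {m} {k} (0<m , b^m∈N , minimal) b^k∈N =
      m%n≡0⇒n∣m k m (n≤0⇒n≡0 (≮⇒≥ λ 0<r → minimal 0<r (m%n<n k m) b^r∈N))
      where
      instance
        m≢0 : NonZero m
        m≢0 = >-nonZero 0<m

      b^k≡b^r∙b^qm : b ^ k ≡ b ^ (k % m) ∙ b ^ (k / m * m)
      b^k≡b^r∙b^qm = trans (cong (b ^_) (m≡m%n+[m/n]*n k m)) (^-+ b (k % m) (k / m * m))

      b^r∈N : b ^ (k % m) ∈ N
      b^r∈N = subst (_∈ N) (//-rightDividesʳ (b ^ (k / m * m)) (b ^ (k % m)))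
        (∙-closed _ _ (subst (_∈ N) b^k≡b^r∙b^qm b^k∈N) (inv-closed _ (^-*-∈N b^m∈N (k / m))))

    order-modulo-∣-n : ∀ {b m} → IsOrderModulo b m → m ∣ n
    order-modulo-∣-n {b} b-order-mod with order-exists b
    ... | d , b-order@(_ , b^d≡e , _) =
      ∣-trans (order-modulo-∣ b-order-mod (subst (_∈ N) (sym b^d≡e) e∈N)) (order-∣ b-order)

    order-modulo≤ : ∀ {b m vs} → IsOrderModulo b m → (∀ k → coset G N (b ^ k) ∈ˡ vs) → m ≤ length vs
    order-modulo≤ {b} {m} {vs} b-order-mod powers∈vs =
      subst (_≤ length vs) (length-applyUpTo cosets m) (unique⊆⇒length≤ _≟ˢ_ cosets-unique cosets⊆vs)
      where
      cosets : ℕ → Subset n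
      cosets k = coset G N (b ^ k)

      cosets-unique : Unique (applyUpTo cosets m)
      cosets-unique = Unique.applyUpTo⁺₁ cosets m λ i<j j<m same →
        powers-distinct (_∈ N) b-order-mod i<j j<m (coset-injective same)

      cosets⊆vs : applyUpTo cosets m ⊆ vs
      cosets⊆vs v∈ with ∈-applyUpTo⁻ cosets v∈
      ... | k , _ , refl = powers∈vs k

    1<order-modulo : ∀ {b m} → b ∉ N → IsOrderModulo b m → 1 < m
    1<order-modulo {b} b∉N (0<m , b^m∈N , _) with m≤n⇒m<n∨m≡n 0<m
    ... | inj₁ 1<m = 1<m
    ... | inj₂ refl = contradiction (subst (_∈ N) (identityʳ b) b^m∈N) b∉N

module ProductCosets {n : ℕ} (G : FinGroup n) (N : Subset n) (N≤G : IsSubgroup G N) (A B : Subset n)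
  where

  open FinGroup G
  open FinGroupProperties G
  open Subgroup N N≤G
  open import Algebra.Properties.Group group using (\\-leftDividesʳ)
  open DecMembership _≟ˢ_ using () renaming (_∈?_ to _∈ˡ?_)

  ∈-ABuBA⁺ : ∀ {g a b} → a ∈ A → b ∈ B → g ≡ a ∙ b ⊎ g ≡ b ∙ a → g ∈ ABuBA G A B
  ∈-ABuBA⁺ a∈A b∈B g≡ab∨ba = ∈-tabulate⁺
    (λ g → any? λ a → any? λ b → (a ∈? A) ×-dec ((b ∈? B) ×-dec ((g ≟ᶠ (a ∙ b)) ⊎-dec (g ≟ᶠ (b ∙ a)))))
    (_ , _ , a∈A , b∈B , g≡ab∨ba)

  bar⊆bar-ABuBA : coset G N e ∈ˡ bar G N B → bar G N A ⊆ bar G N (ABuBA G A B)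
  bar⊆bar-ABuBA ē∈B̄ v∈Ā with ∈-bar⁻ ē∈B̄ | ∈-bar⁻ v∈Ā
  ... | b₀ , b₀∈B , ēN≡b₀N | a , a∈A , refl =
    subst (_∈ˡ bar G N (ABuBA G A B)) (sym (coset-cong a≈ᴺab₀)) (∈-bar⁺ (∈-ABuBA⁺ a∈A b₀∈B (inj₁ refl)))
    where
    a≈ᴺab₀ : a ≈ᴺ a ∙ b₀
    a≈ᴺab₀ = subst (_∈ N) (sym (\\-leftDividesʳ a b₀)) (Equivalence.to e≈ᴺ⇔∈N (coset-injective ēN≡b₀N))

  ∣bar∣≤∣bar-ABuBA∣ : coset G N e ∈ˡ bar G N B → ∣bar∣ G N A ≤ ∣bar∣ G N (ABuBA G A B)
  ∣bar∣≤∣bar-ABuBA∣ ē∈B̄ = unique⊆⇒length≤ _≟ˢ_ (bar-unique A) (bar⊆bar-ABuBA ē∈B̄)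

  new-coset⇒∣bar∣< : coset G N e ∈ˡ bar G N B → ∀ {a b} → a ∈ A → b ∈ B →
                     ¬ coset G N (b ∙ a) ∈ˡ bar G N A → ∣bar∣ G N A < ∣bar∣ G N (ABuBA G A B)
  new-coset⇒∣bar∣< ē∈B̄ {a} {b} a∈A b∈B new =
    unique⊆⇒length≤ _≟ˢ_ (¬Any⇒All¬ (bar G N A) new ∷ bar-unique A) extended⊆
    where
    extended⊆ : coset G N (b ∙ a) ∷ bar G N A ⊆ bar G N (ABuBA G A B)
    extended⊆ (here refl) = ∈-bar⁺ (∈-ABuBA⁺ a∈A b∈B (inj₂ refl))
    extended⊆ (there v∈Ā) = bar⊆bar-ABuBA ē∈B̄ v∈Ā

  Stabilises : Fin n → Set
  Stabilises b = ∀ {a} → a ∈ A → coset G N (b ∙ a) ∈ˡ bar G N A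

  stable⇒powers∈bar : coset G N e ∈ˡ bar G N A → ∀ {b} → Stabilises b →
                      ∀ k → coset G N (b ^ k) ∈ˡ bar G N A
  stable⇒powers∈bar ē∈Ā stable zero = ē∈Ā
  stable⇒powers∈bar ē∈Ā {b} stable (suc k) with ∈-bar⁻ (stable⇒powers∈bar ē∈Ā stable k)
  ... | a , a∈A , b^kN≡aN =
    subst (_∈ˡ bar G N A) (coset-cong (≈ᴺ-∙ˡ b (≈ᴺ-sym (coset-injective b^kN≡aN)))) (stable a∈A)

  stable⇒p≤∣bar∣ : ∀ {p} → IsSmallestPrimeDivisor p n → coset G N e ∈ˡ bar G N A →
                   ∀ {b} → b ∉ N → Stabilises b → p ≤ ∣bar∣ G N A
  stable⇒p≤∣bar∣ p-smallest ē∈Ā {b} b∉N stable with order-modulo-exists b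
  ... | m , b-order-mod = ≤-trans
    (smallest-prime-divisor≤ p-smallest (1<order-modulo b∉N b-order-mod) (order-modulo-∣-n b-order-mod))
    (order-modulo≤ b-order-mod (stable⇒powers∈bar ē∈Ā stable))

  p⊓suc∣bar∣≤∣bar-ABuBA∣ : ∀ {p} → IsSmallestPrimeDivisor p n →
                           coset G N e ∈ˡ bar G N A → coset G N e ∈ˡ bar G N B →
                           ∀ {b} → b ∈ B → b ∉ N → p ⊓ suc (∣bar∣ G N A) ≤ ∣bar∣ G N (ABuBA G A B)
  p⊓suc∣bar∣≤∣bar-ABuBA∣ {p} p-smallest ē∈Ā ē∈B̄ {b} b∈B b∉N
    with any? (λ a → (a ∈? A) ×-dec ¬? (coset G N (b ∙ a) ∈ˡ? bar G N A))
  ... | yes (a , a∈A , new) = ≤-trans (m⊓n≤n p _) (new-coset⇒∣bar∣< ē∈B̄ a∈A b∈B new)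
  ... | no no-new = ≤-trans (m⊓n≤m p _)
    (≤-trans (stable⇒p≤∣bar∣ p-smallest ē∈Ā b∉N stable) (∣bar∣≤∣bar-ABuBA∣ ē∈B̄))
    where
    stable : Stabilises b
    stable {a} a∈A = decidable-stable (coset G N (b ∙ a) ∈ˡ? bar G N A) λ old → no-new (a , a∈A , old)

-- Nonemptiness of A and B is implied by 1̄ ∈ Ā and 1̄ ∈ B̄.
lemma2p5 : (n : ℕ) (G : FinGroup n) (N : Subset n) → IsSubgroup G N →
    (p : ℕ) → IsSmallestPrimeDivisor p n →
    (A B : Subset n) → Nonempty A → Nonempty B →
    (coset G N (FinGroup.e G) ∈ˡ bar G N A) → (coset G N (FinGroup.e G) ∈ˡ bar G N B) →
    2 ≤ ∣bar∣ G N B →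
    p ⊓ suc (∣bar∣ G N A) ≤ ∣bar∣ G N (ABuBA G A B)
lemma2p5 n G N N≤G p p-smallest A B _ _ ē∈Ā ē∈B̄ 2≤∣B̄∣
  with FinGroupProperties.Subgroup.two-cosets⇒∉N G N N≤G 2≤∣B̄∣
... | b , b∈B , b∉N =
  ProductCosets.p⊓suc∣bar∣≤∣bar-ABuBA∣ G N N≤G A B p-smallest ē∈Ā ē∈B̄ b∈B b∉N
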